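{- Let $G$ be an outerplanar graph with vertex set $V$ and edge set $E$ whose components are each either a copy of $K_2$ or an even cycle graph $C_n$ with $n\neq 4$. Then the main diagonal of the magnitude homology of $G$ is torsion-free, with $\mathrm{rank}\,\mathrm{MH}_{0,0}(G)=|V|$ and $\mathrm{rank}\,\mathrm{MH}_{k,k}(G)=2|E|$ for all $k>0$.
   Context: Graphs are finite, undirected, with no loops and no multiple edges. For a graph $G$, $d(x,y)$ denotes the shortest-path distance (edges have length $1$; $\infty$ if no path). A $k$-path is a tuple $(x_0,\dots,x_k)$ of vertices with $x_i\neq x_{i+1}$ and $d(x_i,x_{i+1})<\infty$; its length is $\sum_i d(x_i,x_{i+1})$. $\mathrm{MC}_{k,\ell}(G)$ is the free abelian group on $k$-paths of length $\ell$, with differential $\partial=\sum_{i=1}^{k-1}(-1)^i\partial_i$, where $\partial_i$ deletes $x_i$ if the resulting tuple is a $(k-1)$-path of the same length $\ell$ and is $0$ otherwise; $\mathrm{MH}_{k,\ell}(G)=H_k(\mathrm{MC}_{*,\ell}(G))$; the main diagonal is $(\mathrm{MH}_{k,k}(G))_{k\ge0}$. Outerplanar graphs and their components: a graph is outerplanar if it can be written as $G=H_1\star H_2\star\cdots\star H_t$, where each $H_s$ is a copy of $K_2$ (a single edge) or a cycle graph $C_n$, and for each $s$ the graph $H_1\star\cdots\star H_s$ is formed from $H_1\star\cdots\star H_{s-1}$ by identifying a vertex or an edge of $H_s$ with a vertex or edge, respectively, on the outer face of $H_1\star\cdots\star H_{s-1}$ (with respect to a crossing-free plane drawing with all vertices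 on the outer face). The subgraphs $H_s$ are called the components of $G$. -}

module Defs where

open import Data.Bool using (Bool; true; false; _∧_; _∨_; if_then_else_; not)
open import Data.Nat as ℕ using (ℕ; zero; suc; _≤_; _<ᵇ_)
open import Data.Fin as Fin using (Fin; toℕ; inject₁)
open import Data.Fin.Properties using () renaming (_≟_ to _≟F_)
open import Data.Integer as ℤ using (ℤ; 0ℤ; 1ℤ; -1ℤ)
open import Data.Maybe using (Maybe; just; nothing)
open import Data.Product using (Σ; ∃; _×_; _,_; proj₁)
open import Data.Sum using (_⊎_)
open import Data.Unit using (⊤)
open import Data.Empty using (⊥)
open import Data.List as List using (List; []; _∷_; _++_; concatMap)
open import Data.List.Membership.Propositional using (_∈_)
open import Data.Bool.ListAction using () renaming (any to anyL)
open import Data.List.Relation.Unary.Unique.Propositional using (Unique)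
open import Data.Vec as Vec using (Vec; []; _∷_; insertAt)
open import Relation.Nullary using (¬_)
open import Relation.Nullary.Decidable using (⌊_⌋)
open import Relation.Binary.PropositionalEquality using (_≡_; _≢_)

∑ : (m : ℕ) → (Fin m → ℤ) → ℤ
∑ zero    f = 0ℤ
∑ (suc m) f = f Fin.zero ℤ.+ ∑ m (λ i → f (Fin.suc i))

∑ℕ : (m : ℕ) → (Fin m → ℕ) → ℕ
∑ℕ zero    f = 0
∑ℕ (suc m) f = f Fin.zero ℕ.+ ∑ℕ m (λ i → f (Fin.suc i))

anyFin : (m : ℕ) → (Fin m → Bool) → Bool
anyFin zero    p = false
anyFin (suc m) p = p Fin.zero ∨ anyFin m (λ i → p (Fin.suc i))

sign : ℕ → ℤ
sign zero    = 1ℤ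
sign (suc i) = ℤ.- sign i

-- Magnitude homology of a graph on vertex set Fin N with (symmetric,
-- irreflexive) adjacency relation adj.

module MH {N : ℕ} (adj : Fin N → Fin N → Bool) where

  walk : ℕ → Fin N → Fin N → Bool
  walk zero    x y = ⌊ x ≟F y ⌋
  walk (suc m) x y = anyFin N (λ v → adj x v ∧ walk m v y)

  firstTrue : (ℕ → Bool) → ℕ → ℕ → Maybe ℕ
  firstTrue p start zero       = nothing
  firstTrue p start (suc fuel) =
    if p start then just start else firstTrue p (suc start) fuel

  -- shortest-path distance d(x,y); nothing = ∞.
  -- (A shortest path has at most N-1 edges, so searching m ≤ N suffices.)
  dist : Fin N → Fin N → Maybe ℕ
  dist x y = firstTrue (λ m → walk m x y) 0 (suc N)

  pathLen : {k : ℕ} → Vec (Fin N) (suc k) → Maybe ℕ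
  pathLen (x ∷ [])     = just 0
  pathLen (x ∷ y ∷ xs) with ⌊ x ≟F y ⌋ | dist x y | pathLen (y ∷ xs)
  ... | false | just d | just l = just (d ℕ.+ l)
  ... | _     | _      | _      = nothing

  isPath : {k : ℕ} → ℕ → Vec (Fin N) (suc k) → Bool
  isPath ℓ xs with pathLen xs
  ... | just l  = ⌊ l ℕ.≟ ℓ ⌋
  ... | nothing = false

  -- MC_{k,ℓ}: integer-valued functions on (k+1)-tuples supported on
  -- k-paths of length ℓ (= free abelian group on those k-paths)
  Chain : ℕ → ℕ → Set
  Chain k ℓ = Σ (Vec (Fin N) (suc k) → ℤ)
                (λ c → ∀ x → isPath ℓ x ≡ false → c x ≡ 0ℤ)

  -- ∂ = Σ_{i=1}^{k} (-1)^i ∂_i : MC_{k+1,ℓ} → MC_{k,ℓ}, written as the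
  -- coefficient of a k-path y in ∂c: the (k+1)-paths x with ∂_i x = y are
  -- exactly x = insertAt y i v (i interior) such that x, y are paths of
  -- length ℓ.
  ∂ : {k : ℕ} (ℓ : ℕ) → (Vec (Fin N) (suc (suc k)) → ℤ) → Vec (Fin N) (suc k) → ℤ
  ∂ {k} ℓ c y =
    if isPath ℓ y
    then ∑ k (λ j → sign (suc (toℕ j)) ℤ.*
           ∑ N (λ v → let x = insertAt y (Fin.suc (inject₁ j)) v in
                      if isPath ℓ x then c x else 0ℤ))
    else 0ℤ

  -- cycles Z_{k,ℓ} = ker (∂ : MC_{k,ℓ} → MC_{k-1,ℓ}); ∂ = 0 on MC_{0,ℓ}
  IsCycle : (k ℓ : ℕ) → (Vec (Fin N) (suc k) → ℤ) → Set
  IsCycle zero    ℓ c = ⊤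
  IsCycle (suc k) ℓ c = ∀ y → ∂ {k} ℓ c y ≡ 0ℤ

  Cycle : ℕ → ℕ → Set
  Cycle k ℓ = Σ (Chain k ℓ) (λ c → IsCycle k ℓ (proj₁ c))

  -- c ~ 0 in MH_{k,ℓ} = Z_{k,ℓ} / ∂(MC_{k+1,ℓ})
  IsBoundary : (k ℓ : ℕ) → (Vec (Fin N) (suc k) → ℤ) → Set
  IsBoundary k ℓ c = Σ (Chain (suc k) ℓ) (λ b → ∀ x → c x ≡ ∂ {k} ℓ (proj₁ b) x)

  lin : {k ℓ r : ℕ} → (Fin r → ℤ) → (Fin r → Cycle k ℓ) → Vec (Fin N) (suc k) → ℤ
  lin {r = r} a z x = ∑ r (λ i → a i ℤ.* proj₁ (proj₁ (z i)) x)

  TorsionFree : ℕ → ℕ → Set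
  TorsionFree k ℓ = (z : Cycle k ℓ) (m : ℤ) → m ≢ 0ℤ →
    IsBoundary k ℓ (λ x → m ℤ.* proj₁ (proj₁ z) x) → IsBoundary k ℓ (proj₁ (proj₁ z))

  Independent : {k ℓ r : ℕ} → (Fin r → Cycle k ℓ) → Set
  Independent {k} {ℓ} {r} z = (a : Fin r → ℤ) → IsBoundary k ℓ (lin a z) → ∀ i → a i ≡ 0ℤ

  HasRank : ℕ → ℕ → ℕ → Set
  HasRank k ℓ r = (Σ (Fin r → Cycle k ℓ) Independent)
                × ((z : Fin (suc r) → Cycle k ℓ) → ¬ Independent z)

  edgeCount : ℕ
  edgeCount = ∑ℕ N (λ i → ∑ℕ N (λ j →
                if (toℕ i <ᵇ toℕ j) ∧ adj i j then 1 else 0))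

-- Outerplanar graphs built from components, realised on vertex set Fin N.
-- A component is a copy of K₂ (two vertices) or a cycle C_{3+m} given by
-- its cyclically ordered vertices.

data Comp (N : ℕ) : Set where
  k2  : Fin N → Fin N → Comp N
  cyc : (m : ℕ) → Vec (Fin N) (3 ℕ.+ m) → Comp N

verts : {N : ℕ} → Comp N → List (Fin N)
verts (k2 a b)   = a ∷ b ∷ []
verts (cyc m vs) = Vec.toList vs

cycEdges : {N n : ℕ} → Fin N → Vec (Fin N) (suc n) → List (Fin N × Fin N)
cycEdges v0 (x ∷ [])     = (x , v0) ∷ []
cycEdges v0 (x ∷ y ∷ xs) = (x , y) ∷ cycEdges v0 (y ∷ xs)

edges : {N : ℕ} → Comp N → List (Fin N × Fin N)
edges (k2 a b)           = (a , b) ∷ []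
edges (cyc m (x ∷ xs))   = cycEdges x (x ∷ xs)

isCyc : {N : ℕ} → Comp N → Bool
isCyc (k2 _ _)  = false
isCyc (cyc _ _) = true

sameEdge : {N : ℕ} → Fin N → Fin N → Fin N × Fin N → Bool
sameEdge u v (a , b) = (⌊ u ≟F a ⌋ ∧ ⌊ v ≟F b ⌋) ∨ (⌊ u ≟F b ⌋ ∧ ⌊ v ≟F a ⌋)

hasEdge : {N : ℕ} → Comp N → Fin N → Fin N → Bool
hasEdge H u v = anyL (sameEdge u v) (edges H)

adjOf : {N : ℕ} → List (Comp N) → Fin N → Fin N → Bool
adjOf Hs u v = anyL (λ H → hasEdge H u v) Hs

cycCount : {N : ℕ} → List (Comp N) → Fin N → Fin N → ℕ
cycCount []       u v = 0
cycCount (H ∷ Hs) u v =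
  (if isCyc H ∧ hasEdge H u v then 1 else 0) ℕ.+ cycCount Hs u v

CompWF : {N : ℕ} → Comp N → Set
CompWF H = Unique (verts H)

-- an edge uv of the graph built from prev is on the outer face iff it lies
-- in at most one cycle component
OuterEdge : {N : ℕ} → List (Comp N) → Fin N → Fin N → Set
OuterEdge prev u v = (adjOf prev u v ≡ true) × (cycCount prev u v ≤ 1)

-- H is glued onto the graph built from prev by identifying one vertex of H
-- with a vertex of it, or an edge of H with an outer-face edge of it; all
-- other vertices of H are new.
Attach : {N : ℕ} → List (Comp N) → Comp N → Set
Attach prev H =
    (∃ λ w → w ∈ verts H × ∀ x → x ∈ verts H → (x ∈ concatMap verts prev → x ≡ w)
                                × (x ≡ w → x ∈ concatMap verts prev))
  ⊎ (∃ λ u → ∃ λ v → (hasEdge H u v ≡ true) × OuterEdge prev u v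
       × (∀ x → x ∈ verts H → (x ∈ concatMap verts prev → (x ≡ u ⊎ x ≡ v))
                             × ((x ≡ u ⊎ x ≡ v) → x ∈ concatMap verts prev)))

AttachSeq : {N : ℕ} → List (Comp N) → List (Comp N) → Set
AttachSeq prev []       = ⊤
AttachSeq prev (H ∷ Hs) = CompWF H × Attach prev H × AttachSeq (prev ++ (H ∷ [])) Hs

Outerplanar : (N : ℕ) → Comp N → List (Comp N) → Set
Outerplanar N H₁ Hs = CompWF H₁ × AttachSeq (H₁ ∷ []) Hs
                    × (∀ (x : Fin N) → x ∈ concatMap verts (H₁ ∷ Hs))

GoodComp : {N : ℕ} → Comp N → Set
GoodComp (k2 _ _)   = ⊤
GoodComp (cyc m _)  = (∃ λ h → 3 ℕ.+ m ≡ 2 ℕ.* h) × (3 ℕ.+ m ≢ 4)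

-- On the diagonal ℓ = k a k-path of length k is just a walk, and no (k+1)-path has length k, so
-- MH_{k,k} is the group of cycles itself: there are no boundaries and no torsion.  In degree 0 every
-- vertex is a cycle.  In degree k + 1, if the graph has girth at least 5, a cycle z vanishes on every
-- walk x with x_g ≠ x_{g+2}: deleting x_{g+1} leaves a path y, and x is the only way of reinserting a
-- vertex into y, so (∂z)(y) = ±z(x).  Cycles are therefore supported on the back-and-forth walks
-- (a, b, a, b, …) along the 2|E| oriented edges, whose indicator functions are cycles; hence the rank
-- is 2|E|.  Finally K₂ and the cycles C_n with n ≥ 5 have girth at least 5 (this is the only use of
-- n being even and n ≠ 4), and gluing two such graphs along a vertex or an edge keeps the girth at
-- least 5.
module Submission where

open import Defs
import Algebra.Properties.Semiring.Sum as SemiringSum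
open import Data.Bool using (Bool; true; false; T; _∧_; if_then_else_)
open import Data.Bool.Properties using (T-∧; T-∨; T-≡; T-irrelevant; ¬-not)
open import Data.Fin as Fin using (Fin; zero; suc; punchIn; inject₁; toℕ)
import Data.Fin.Properties as FinP
open import Data.Integer as ℤ using (ℤ; 0ℤ; 1ℤ; _+_; -_; _-_)
import Data.Integer.Properties as ℤP
open import Data.Integer.Solver using (module +-*-Solver)
open import Data.List using (List; []; _∷_; _++_; concatMap)
open import Data.List.Membership.Propositional using (_∈_; _∉_; find; lose)
open import Data.List.Membership.Propositional.Properties using (∈-++⁺ˡ; ∈-++⁺ʳ)
import Data.List.Properties as LP
open import Data.List.Relation.Unary.All as All using (All; []; _∷_)
open import Data.List.Relation.Unary.AllPairs using ([]; _∷_)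
open import Data.List.Relation.Unary.Any using (here; there)
open import Data.List.Relation.Unary.Any.Properties using (any⁺; any⁻; ++⁺ˡ; ++⁺ʳ; ++⁻)
open import Data.List.Relation.Unary.Unique.Propositional using (Unique)
open import Data.Maybe using (just)
open import Data.Maybe.Properties using (just-injective)
open import Data.Nat as ℕ using (ℕ; zero; suc; _*_; s≤s; z≤n; _<_; _≤_; _<ᵇ_)
open import Data.Nat.DivMod using (m*n%n≡0)
open import Data.Nat.GeneralisedArithmetic using (fold)
import Data.Nat.Properties as ℕP
open import Data.Product using (Σ; ∃; ∃₂; _×_; _,_; proj₁; proj₂)
import Data.Product.Function.Dependent.Propositional as Σ
open import Data.Product.Function.NonDependent.Propositional using (_×-↔_)
open import Data.Sum as Sum using (_⊎_; inj₁; inj₂; [_,_]′)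
open import Data.Sum.Function.Propositional using (_⊎-↔_)
open import Data.Unit using (tt)
open import Data.Vec as Vec using (Vec; []; _∷_; lookup; insertAt)
open import Data.Vec.Functional as Vector using (removeAt)
open import Data.Vec.Functional.Properties using (insertAt-lookup; insertAt-punchIn)
open import Data.Vec.Membership.Propositional.Properties using (∈-lookup; ∈-toList⁺)
import Data.Vec.Properties as VecP
open import Data.Vec.Relation.Unary.Linked as Linked using (Linked; []; [-]; _∷_)
open import Function using (_∘_; Equivalence; Inverse; Injection; _⇔_; mk⇔; _↔_; mk↔ₛ′)
open import Function.Definitions using (Injective)
open import Function.Properties.Inverse using (↔-refl; ↔-trans; ↔⇒↣)
open import Relation.Binary.Construct.Union using (_∪_)
open import Relation.Binary.Definitions using (DecidableEquality; tri<; tri≈; tri>)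
open import Relation.Binary.PropositionalEquality
open import Relation.Nullary using (¬_; yes; no; contradiction)
open import Relation.Nullary.Decidable using (⌊_⌋; toWitness; fromWitness; T?)

open SemiringSum ℤP.+-*-semiring
  using (sum; sum-cong-≗; sum-replicate-zero; sum-remove; *-distribˡ-sum; ∑-distrib-+)

∑≡sum : ∀ m (f : Fin m → ℤ) → ∑ m f ≡ sum f
∑≡sum zero    f = refl
∑≡sum (suc m) f = cong (f zero +_) (∑≡sum m (f ∘ suc))

sum-zero : ∀ {m} {f : Fin m → ℤ} → (∀ i → f i ≡ 0ℤ) → sum f ≡ 0ℤ
sum-zero {m} f≗0 = trans (sum-cong-≗ f≗0) (sum-replicate-zero m)

sum-scale : ∀ {m} x (f : Fin m → ℤ) → sum (λ i → x ℤ.* f i) ≡ x ℤ.* sum f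
sum-scale x f = sym (*-distribˡ-sum x f)

sum-linear : ∀ {m} x y (f g : Fin m → ℤ) →
             sum (λ i → x ℤ.* f i + y ℤ.* g i) ≡ x ℤ.* sum f + y ℤ.* sum g
sum-linear x y f g =
  trans (∑-distrib-+ (λ i → x ℤ.* f i) (λ i → y ℤ.* g i)) (cong₂ _+_ (sum-scale x f) (sum-scale y g))

∑-zero : ∀ m {f : Fin m → ℤ} → (∀ i → f i ≡ 0ℤ) → ∑ m f ≡ 0ℤ
∑-zero m {f} f≗0 = trans (∑≡sum m f) (sum-zero f≗0)

∑-single : ∀ {m} {f : Fin m → ℤ} i → (∀ j → j ≢ i → f j ≡ 0ℤ) → ∑ m f ≡ f i
∑-single {suc m} {f} i others = begin
  ∑ (suc m) f              ≡⟨ ∑≡sum (suc m) f ⟩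
  sum f                    ≡⟨ sum-remove f ⟩
  f i + sum (removeAt f i) ≡⟨ cong (f i +_) (sum-zero (λ j → others _ (FinP.punchInᵢ≢i i j))) ⟩
  f i + 0ℤ                 ≡⟨ ℤP.+-identityʳ (f i) ⟩
  f i                      ∎
  where open ≡-Reasoning

IsRelation : ∀ {m n} → (Fin m → Fin n → ℤ) → (Fin m → ℤ) → Set
IsRelation v a = ∀ e → sum (λ i → a i ℤ.* v i e) ≡ 0ℤ

NonTrivial : ∀ {m} → (Fin m → ℤ) → Set
NonTrivial a = ∃ λ i → a i ≢ 0ℤ

*-≢0 : ∀ {x y} → x ≢ 0ℤ → y ≢ 0ℤ → x ℤ.* y ≢ 0ℤ
*-≢0 {x} x≢0 y≢0 xy≡0 with ℤP.i*j≡0⇒i≡0∨j≡0 x xy≡0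
... | inj₁ x≡0 = x≢0 x≡0
... | inj₂ y≡0 = y≢0 y≡0

module Elimination {m n} (v : Fin (suc m) → Fin (suc n) → ℤ) (p : Fin (suc m)) where
  open +-*-Solver using (solve; _:+_; _:*_; :-_; _:=_; con)
  open ≡-Reasoning

  c : ℤ
  c = v p zero

  rest : Fin m → Fin (suc n) → ℤ
  rest j = v (punchIn p j)

  reduced : Fin m → Fin n → ℤ
  reduced j e = c ℤ.* rest j (suc e) - rest j zero ℤ.* v p (suc e)

  -- A relation b of the reduced rows, scaled by c, is completed at the pivot row p so that the
  -- first column cancels as well.
  lift : (Fin m → ℤ) → Fin (suc m) → ℤ
  lift b = Vector.insertAt (λ j → c ℤ.* b j) p (- sum (λ j → b j ℤ.* rest j zero))

  lift-nonTrivial : ∀ {b} → c ≢ 0ℤ → NonTrivial b → NonTrivial (lift b)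
  lift-nonTrivial {b} c≢0 (j , bⱼ≢0) =
    punchIn p j , subst (_≢ 0ℤ) (sym (insertAt-punchIn _ p _ j)) (*-≢0 c≢0 bⱼ≢0)

  lift-relation : ∀ {b} → IsRelation reduced b → IsRelation v (lift b)
  lift-relation {b} b-relation e = trans (split e) (cancels e)
    where
    S : Fin (suc n) → ℤ
    S e = sum (λ j → b j ℤ.* rest j e)

    split : ∀ e → sum (λ i → lift b i ℤ.* v i e) ≡ - S zero ℤ.* v p e + c ℤ.* S e
    split e = begin
      sum (λ i → lift b i ℤ.* v i e)
        ≡⟨ sum-remove {i = p} (λ i → lift b i ℤ.* v i e) ⟩
      lift b p ℤ.* v p e + sum (λ j → lift b (punchIn p j) ℤ.* rest j e)
        ≡⟨ cong₂ _+_ (cong (ℤ._* v p e) (insertAt-lookup _ p _))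
                     (sum-cong-≗ λ j → trans (cong (ℤ._* rest j e) (insertAt-punchIn _ p _ j))
                                             (ℤP.*-assoc c (b j) (rest j e))) ⟩
      - S zero ℤ.* v p e + sum (λ j → c ℤ.* (b j ℤ.* rest j e))
        ≡⟨ cong (- S zero ℤ.* v p e +_) (sum-scale c (λ j → b j ℤ.* rest j e)) ⟩
      - S zero ℤ.* v p e + c ℤ.* S e
        ∎

    cancels : ∀ e → - S zero ℤ.* v p e + c ℤ.* S e ≡ 0ℤ
    cancels zero    = solve 2 (λ s c → (:- s) :* c :+ c :* s := con 0ℤ) refl (S zero) c
    cancels (suc e) = begin
      - S zero ℤ.* q + c ℤ.* S (suc e)
        ≡⟨ solve 3 (λ s₀ q cs → (:- s₀) :* q :+ cs := cs :+ (:- q) :* s₀)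
                 refl (S zero) q (c ℤ.* S (suc e)) ⟩
      c ℤ.* S (suc e) + - q ℤ.* S zero
        ≡⟨ sum-linear c (- q) (λ j → b j ℤ.* rest j (suc e)) (λ j → b j ℤ.* rest j zero) ⟨
      sum (λ j → c ℤ.* (b j ℤ.* rest j (suc e)) + - q ℤ.* (b j ℤ.* rest j zero))
        ≡⟨ sum-cong-≗ (λ j → solve 5 (λ b c r₁ r₀ q → c :* (b :* r₁) :+ (:- q) :* (b :* r₀)
                                                      := b :* (c :* r₁ :+ :- (r₀ :* q)))
                                      refl (b j) c (rest j (suc e)) (rest j zero) q) ⟩
      sum (λ j → b j ℤ.* reduced j e)
        ≡⟨ b-relation e ⟩
      0ℤ
        ∎
      where q = v p (suc e)

rows-dependent : ∀ {m n} → n < m → (v : Fin m → Fin n → ℤ) → ∃ λ a → NonTrivial a × IsRelation v a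
rows-dependent {suc m} {zero}  _         v = (λ _ → 1ℤ) , (zero , λ ()) , λ ()
rows-dependent {suc m} {suc n} (s≤s n<m) v with FinP.all? (λ i → v i zero ℤ.≟ 0ℤ)
... | yes column₀≡0 with rows-dependent (ℕP.m<n⇒m<1+n n<m) (λ i → v i ∘ suc)
...   | a , a-nonTrivial , a-relation = a , a-nonTrivial , λ
        { zero    → sum-zero (λ i → trans (cong (a i ℤ.*_) (column₀≡0 i)) (ℤP.*-zeroʳ (a i)))
        ; (suc e) → a-relation e
        }
rows-dependent {suc m} {suc n} (s≤s n<m) v | no column₀≢0
  with FinP.¬∀⟶∃¬ _ _ (λ i → v i zero ℤ.≟ 0ℤ) column₀≢0
... | p , pivot≢0 with rows-dependent n<m (Elimination.reduced v p)
...   | b , b-nonTrivial , b-relation = lift b , lift-nonTrivial pivot≢0 b-nonTrivial , lift-relation b-relation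
  where open Elimination v p

record Girth≥5 {V : Set} (_~_ : V → V → Set) : Set where
  field
    symmetric   : ∀ {x y} → x ~ y → y ~ x
    irreflexive : ∀ {x} → ¬ x ~ x
    no-triangle : ∀ {x y z} → x ~ y → y ~ z → ¬ x ~ z
    no-square   : ∀ {a b c d} → a ~ b → b ~ c → c ~ d → d ~ a → a ≢ c → b ≡ d

Girth≥5-resp-⇔ : ∀ {V : Set} {_~_ _≈_ : V → V → Set} →
                 (∀ {x y} → x ~ y ⇔ x ≈ y) → Girth≥5 _~_ → Girth≥5 _≈_
Girth≥5-resp-⇔ {_~_ = _~_} {_≈_} ~⇔≈ G = record
  { symmetric   = λ x≈y → to (symmetric (from x≈y))
  ; irreflexive = λ x≈x → irreflexive (from x≈x)
  ; no-triangle = λ x≈y y≈z x≈z → no-triangle (from x≈y) (from y≈z) (from x≈z)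
  ; no-square   = λ a≈b b≈c c≈d d≈a → no-square (from a≈b) (from b≈c) (from c≈d) (from d≈a)
  }
  where
  open Girth≥5 G

  to : ∀ {x y} → x ~ y → x ≈ y
  to = Equivalence.to ~⇔≈

  from : ∀ {x y} → x ≈ y → x ~ y
  from = Equivalence.from ~⇔≈

module Successor {I : Set} (s : I → I) (s-injective : Injective _≡_ _≡_ s)
                 (s¹≢id : ∀ i → s i ≢ i) (s³≢id : ∀ i → s (s (s i)) ≢ i)
                 (s⁴≢id : ∀ i → s (s (s (s i))) ≢ i)
                 where

  _⋈_ : I → I → Set
  i ⋈ j = j ≡ s i ⊎ i ≡ s j

  girth≥5 : Girth≥5 _⋈_
  girth≥5 = record
    { symmetric   = Sum.swap
    ; irreflexive = λ { (inj₁ i≡sᵢ) → s¹≢id _ (sym i≡sᵢ) ; (inj₂ i≡sᵢ) → s¹≢id _ (sym i≡sᵢ) }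
    ; no-triangle = no-triangle
    ; no-square   = no-square
    }
    where
    no-triangle : ∀ {a b c} → a ⋈ b → b ⋈ c → ¬ a ⋈ c
    no-triangle {a} (inj₁ refl) (inj₁ refl) (inj₁ e)    = s¹≢id a (s-injective e)
    no-triangle {a} (inj₁ refl) (inj₁ refl) (inj₂ e)    = s³≢id a (sym e)
    no-triangle {a} (inj₁ refl) (inj₂ e)    (inj₁ refl) = s¹≢id a (sym (s-injective e))
    no-triangle {a} (inj₁ refl) (inj₂ e)    (inj₂ e′)   =
      s¹≢id a (sym (trans e′ (cong s (sym (s-injective e)))))
    no-triangle     (inj₂ refl) (inj₁ refl) (inj₁ e)    = s¹≢id _ (sym (s-injective e))
    no-triangle     (inj₂ refl) (inj₁ refl) (inj₂ e)    = s¹≢id _ (sym (s-injective e))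
    no-triangle     (inj₂ refl) (inj₂ refl) (inj₁ e)    = s³≢id _ (sym e)
    no-triangle     (inj₂ refl) (inj₂ refl) (inj₂ e)    = s¹≢id _ (s-injective e)

    no-square : ∀ {a b c d} → a ⋈ b → b ⋈ c → c ⋈ d → d ⋈ a → a ≢ c → b ≡ d
    no-square (inj₁ e₁) _         _         (inj₂ e₄) _   = trans e₁ (sym e₄)
    no-square (inj₂ e₁) _         _         (inj₁ e₄) _   = s-injective (trans (sym e₁) e₄)
    no-square _         (inj₁ e₂) (inj₂ e₃) _         _   = s-injective (trans (sym e₂) e₃)
    no-square _         (inj₂ e₂) (inj₁ e₃) _         _   = trans e₂ (sym e₃)
    no-square (inj₁ e₁) (inj₂ e₂) (inj₂ _)  (inj₁ _)  a≢c =
      contradiction (sym (s-injective (trans (sym e₂) e₁))) a≢c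
    no-square (inj₂ e₁) (inj₁ e₂) (inj₁ _)  (inj₂ _)  a≢c = contradiction (trans e₁ (sym e₂)) a≢c
    no-square {a} (inj₁ e₁) (inj₁ e₂) (inj₁ e₃) (inj₁ e₄) _ =
      contradiction (sym (trans e₄ (cong s (trans e₃ (cong s (trans e₂ (cong s e₁))))))) (s⁴≢id a)
    no-square {b = b} (inj₂ e₁) (inj₂ e₂) (inj₂ e₃) (inj₂ e₄) _ =
      contradiction (sym (trans e₂ (cong s (trans e₃ (cong s (trans e₄ (cong s e₁))))))) (s⁴≢id b)

girth≥5-image : ∀ {I V : Set} {_⋈_ : I → I → Set} {_~_ : V → V → Set} (f : I → V) →
                Injective _≡_ _≡_ f → (∀ {x y} → x ~ y → y ~ x) →
                (∀ {x y} → x ~ y → ∃₂ λ i j → x ≡ f i × y ≡ f j × i ⋈ j) →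
                Girth≥5 _⋈_ → Girth≥5 _~_
girth≥5-image {_⋈_ = _⋈_} {_~_} f f-injective ~-symmetric ~⇒⋈ G = record
  { symmetric   = ~-symmetric
  ; irreflexive = irreflexive′
  ; no-triangle = no-triangle′
  ; no-square   = no-square′
  }
  where
  open Girth≥5 G

  index : ∀ {x y} → x ~ y → ∃ λ i → x ≡ f i
  index x~y = let i , _ , x≡fᵢ , _ = ~⇒⋈ x~y in i , x≡fᵢ

  pull : ∀ {i j} → f i ~ f j → i ⋈ j
  pull fᵢ~fⱼ with ~⇒⋈ fᵢ~fⱼ
  ... | _ , _ , fᵢ≡fᵢ′ , fⱼ≡fⱼ′ , i′⋈j′
    rewrite f-injective fᵢ≡fᵢ′ | f-injective fⱼ≡fⱼ′ = i′⋈j′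

  irreflexive′ : ∀ {x} → ¬ x ~ x
  irreflexive′ x~x with index x~x
  ... | _ , refl = irreflexive (pull x~x)

  no-triangle′ : ∀ {x y z} → x ~ y → y ~ z → ¬ x ~ z
  no-triangle′ x~y y~z x~z with index x~y | index y~z | index (~-symmetric x~z)
  ... | _ , refl | _ , refl | _ , refl = no-triangle (pull x~y) (pull y~z) (pull x~z)

  no-square′ : ∀ {a b c d} → a ~ b → b ~ c → c ~ d → d ~ a → a ≢ c → b ≡ d
  no-square′ a~b b~c c~d d~a a≢c with index a~b | index b~c | index c~d | index d~a
  ... | _ , refl | _ , refl | _ , refl | _ , refl =
    cong f (no-square (pull a~b) (pull b~c) (pull c~d) (pull d~a) (a≢c ∘ cong f))

module Union {V : Set} (_≟_ : DecidableEquality V) {_~₁_ _~₂_ : V → V → Set} {V₁ V₂ : List V}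
             (G₁ : Girth≥5 _~₁_) (G₂ : Girth≥5 _~₂_)
             (∈V₁ : ∀ {x y} → x ~₁ y → x ∈ V₁) (∈V₂ : ∀ {x y} → x ~₂ y → x ∈ V₂)
             (shared-adjacent : ∀ {x y} → x ∈ V₁ → x ∈ V₂ → y ∈ V₁ → y ∈ V₂ → x ≢ y →
                                x ~₁ y × x ~₂ y)
             where

  open import Data.List.Membership.DecPropositional _≟_ using (_∈?_)

  private
    module G₁ = Girth≥5 G₁
    module G₂ = Girth≥5 G₂

    module Side {_~ᵃ_ _~ᵇ_ : V → V → Set} {Vᵃ Vᵇ : List V} (Gᵇ : Girth≥5 _~ᵇ_)
                (∈Vᵃ : ∀ {x y} → x ~ᵃ y → x ∈ Vᵃ) (∈Vᵇ : ∀ {x y} → x ~ᵇ y → x ∈ Vᵇ)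
                (shared : ∀ {x y} → x ∈ Vᵃ → x ∈ Vᵇ → y ∈ Vᵃ → y ∈ Vᵇ → x ≢ y → x ~ᵃ y)
                where
      open Girth≥5 Gᵇ

      inside : ∀ {x y} → (_~ᵃ_ ∪ _~ᵇ_) x y → x ∈ Vᵃ → y ∈ Vᵃ → x ~ᵃ y
      inside (inj₁ x~y) _    _    = x~y
      inside (inj₂ x~y) x∈Vᵃ y∈Vᵃ =
        shared x∈Vᵃ (∈Vᵇ x~y) y∈Vᵃ (∈Vᵇ (symmetric x~y)) λ { refl → irreflexive x~y }

      outside : ∀ {x y} → (_~ᵃ_ ∪ _~ᵇ_) x y → x ∉ Vᵃ → x ~ᵇ y
      outside (inj₁ x~y) x∉Vᵃ = contradiction (∈Vᵃ x~y) x∉Vᵃ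
      outside (inj₂ x~y) _    = x~y

  _~_ : V → V → Set
  _~_ = _~₁_ ∪ _~₂_

  shared₁ : ∀ {x y} → x ∈ V₁ → x ∈ V₂ → y ∈ V₁ → y ∈ V₂ → x ≢ y → x ~₁ y
  shared₁ x₁ x₂ y₁ y₂ x≢y = proj₁ (shared-adjacent x₁ x₂ y₁ y₂ x≢y)

  shared₂ : ∀ {x y} → x ∈ V₂ → x ∈ V₁ → y ∈ V₂ → y ∈ V₁ → x ≢ y → x ~₂ y
  shared₂ x₂ x₁ y₂ y₁ x≢y = proj₂ (shared-adjacent x₁ x₂ y₁ y₂ x≢y)

  open Side G₂ ∈V₁ ∈V₂ shared₁ renaming (inside to inside₁; outside to outside₁)

  inside₂ : ∀ {x y} → x ~ y → x ∈ V₂ → y ∈ V₂ → x ~₂ y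
  inside₂ = Side.inside G₁ ∈V₂ ∈V₁ shared₂ ∘ Sum.swap

  outside₂ : ∀ {x y} → x ~ y → x ∉ V₂ → x ~₁ y
  outside₂ = Side.outside G₁ ∈V₂ ∈V₁ shared₂ ∘ Sum.swap

  symmetric : ∀ {x y} → x ~ y → y ~ x
  symmetric = Sum.map G₁.symmetric G₂.symmetric

  no-triangle-outside₁ : ∀ {p q r} → p ∉ V₁ → p ~ q → p ~ r → ¬ q ~ r
  no-triangle-outside₁ p∉V₁ p~q p~r q~r = G₂.no-triangle (G₂.symmetric p~₂q) p~₂r
    (inside₂ q~r (∈V₂ (G₂.symmetric p~₂q)) (∈V₂ (G₂.symmetric p~₂r)))
    where
    p~₂q = outside₁ p~q p∉V₁
    p~₂r = outside₁ p~r p∉V₁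

  -- If r ∉ V₂, then q and t are shared vertices adjacent to r in the first graph, and the shared
  -- edge qt closes a triangle there.
  no-square-outside₁ : ∀ {p q r t} → p ∉ V₁ → p ~ q → q ~ r → r ~ t → t ~ p → p ≢ r → q ≡ t
  no-square-outside₁ {p} {q} {r} {t} p∉V₁ p~q q~r r~t t~p p≢r with q ≟ t | r ∈? V₂
  ... | yes q≡t | _ = q≡t
  ... | no _ | yes r∈V₂ =
    G₂.no-square p~₂q (inside₂ q~r q∈V₂ r∈V₂) (inside₂ r~t r∈V₂ t∈V₂) (G₂.symmetric p~₂t) p≢r
    where
    p~₂q = outside₁ p~q p∉V₁
    p~₂t = outside₁ (symmetric t~p) p∉V₁
    q∈V₂ = ∈V₂ (G₂.symmetric p~₂q)
    t∈V₂ = ∈V₂ (G₂.symmetric p~₂t)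
  ... | no q≢t | no r∉V₂ = contradiction q~₁t (G₁.no-triangle (G₁.symmetric r~₁q) r~₁t)
    where
    r~₁q = outside₂ (symmetric q~r) r∉V₂
    r~₁t = outside₂ r~t r∉V₂
    q∈V₂ = ∈V₂ (G₂.symmetric (outside₁ p~q p∉V₁))
    t∈V₂ = ∈V₂ (G₂.symmetric (outside₁ (symmetric t~p) p∉V₁))
    q~₁t = shared₁ (∈V₁ (G₁.symmetric r~₁q)) q∈V₂ (∈V₁ (G₁.symmetric r~₁t)) t∈V₂ q≢t

  girth≥5 : Girth≥5 _~_
  girth≥5 = record
    { symmetric   = symmetric
    ; irreflexive = λ { (inj₁ x~x) → G₁.irreflexive x~x ; (inj₂ x~x) → G₂.irreflexive x~x }
    ; no-triangle = no-triangle
    ; no-square   = no-square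
    }
    where
    no-triangle : ∀ {a b c} → a ~ b → b ~ c → ¬ a ~ c
    no-triangle {a} {b} {c} a~b b~c a~c with a ∈? V₁ | b ∈? V₁ | c ∈? V₁
    ... | no a∉V₁ | _       | _       = no-triangle-outside₁ a∉V₁ a~b a~c b~c
    ... | yes _   | no b∉V₁ | _       = no-triangle-outside₁ b∉V₁ (symmetric a~b) b~c a~c
    ... | yes _   | yes _   | no c∉V₁ = no-triangle-outside₁ c∉V₁ (symmetric a~c) (symmetric b~c) a~b
    ... | yes a∈V₁ | yes b∈V₁ | yes c∈V₁ =
      G₁.no-triangle (inside₁ a~b a∈V₁ b∈V₁) (inside₁ b~c b∈V₁ c∈V₁) (inside₁ a~c a∈V₁ c∈V₁)

    no-square : ∀ {a b c d} → a ~ b → b ~ c → c ~ d → d ~ a → a ≢ c → b ≡ d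
    no-square {a} {b} {c} {d} a~b b~c c~d d~a a≢c with b ≟ d
    ... | yes b≡d = b≡d
    ... | no b≢d with a ∈? V₁ | b ∈? V₁ | c ∈? V₁ | d ∈? V₁
    ... | no a∉V₁ | _       | _       | _       = no-square-outside₁ a∉V₁ a~b b~c c~d d~a a≢c
    ... | yes _   | no b∉V₁ | _       | _       =
      contradiction (sym (no-square-outside₁ b∉V₁ b~c c~d d~a a~b b≢d)) a≢c
    ... | yes _   | yes _   | no c∉V₁ | _       = sym (no-square-outside₁ c∉V₁ c~d d~a a~b b~c (a≢c ∘ sym))
    ... | yes _   | yes _   | yes _   | no d∉V₁ =
      contradiction (no-square-outside₁ d∉V₁ d~a a~b b~c c~d (b≢d ∘ sym)) a≢c
    ... | yes a∈V₁ | yes b∈V₁ | yes c∈V₁ | yes d∈V₁ =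
      G₁.no-square (inside₁ a~b a∈V₁ b∈V₁) (inside₁ b~c b∈V₁ c∈V₁) (inside₁ c~d c∈V₁ d∈V₁)
                   (inside₁ d~a d∈V₁ a∈V₁) a≢c

anyFin⁺ : ∀ {m} (p : Fin m → Bool) i → T (p i) → T (anyFin m p)
anyFin⁺ p zero    pᵢ = Equivalence.from T-∨ (inj₁ pᵢ)
anyFin⁺ p (suc i) pᵢ = Equivalence.from (T-∨ {p zero}) (inj₂ (anyFin⁺ (p ∘ suc) i pᵢ))

anyFin⁻ : ∀ {m} (p : Fin m → Bool) → T (anyFin m p) → ∃ λ i → T (p i)
anyFin⁻ {suc m} p h with Equivalence.to (T-∨ {p zero}) h
... | inj₁ p₀ = zero , p₀
... | inj₂ pₛ with anyFin⁻ (p ∘ suc) pₛ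
...   | i , pᵢ = suc i , pᵢ

≢⇒2≤ : ∀ {n} {x y : Fin n} → x ≢ y → 2 ≤ n
≢⇒2≤ {1}             {zero} {zero} x≢y = contradiction refl x≢y
≢⇒2≤ {suc (suc n)}   _                 = s≤s (s≤s z≤n)

sign≢0 : ∀ n → sign n ≢ 0ℤ
sign≢0 zero    ()
sign≢0 (suc n) eq = sign≢0 n (trans (sym (ℤP.neg-involutive (sign n))) (cong -_ eq))

module Paths {N : ℕ} (adj : Fin N → Fin N → Bool) where
  open MH adj

  _~_ : Fin N → Fin N → Set
  x ~ y = T (adj x y)

  Tuple : ℕ → Set
  Tuple k = Vec (Fin N) (suc k)

  walk₀⁻ : ∀ {x y} → T (walk 0 x y) → x ≡ y
  walk₀⁻ = toWitness

  walk₁⁺ : ∀ {x y} → x ~ y → T (walk 1 x y)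
  walk₁⁺ {x} {y} x~y = anyFin⁺ _ y (Equivalence.from T-∧ (x~y , fromWitness refl))

  walk₁⁻ : ∀ {x y} → T (walk 1 x y) → x ~ y
  walk₁⁻ {x} {y} h with anyFin⁻ _ h
  ... | v , t with Equivalence.to (T-∧ {adj x v}) t
  ...   | x~v , v≡y = subst (x ~_) (walk₀⁻ v≡y) x~v

  walk₂⁺ : ∀ {x v y} → x ~ v → v ~ y → T (walk 2 x y)
  walk₂⁺ {v = v} x~v v~y = anyFin⁺ _ v (Equivalence.from T-∧ (x~v , walk₁⁺ v~y))

  firstTrue-sound : ∀ p s fuel {d} → firstTrue p s fuel ≡ just d → T (p d)
  firstTrue-sound p s (suc fuel) eq with p s in pₛ
  ... | true  = subst (T ∘ p) (just-injective eq) (Equivalence.from T-≡ pₛ)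
  ... | false = firstTrue-sound p (suc s) fuel eq

  firstTrue-least : ∀ p {s fuel} j → j < fuel → (∀ i → i < j → ¬ T (p (i ℕ.+ s))) →
                    T (p (j ℕ.+ s)) → firstTrue p s fuel ≡ just (j ℕ.+ s)
  firstTrue-least p {s} {suc fuel} zero    _            _     pₛ with p s | pₛ
  ... | true | _ = refl
  firstTrue-least p {s} {suc fuel} (suc j) (s≤s j<fuel) below pⱼ with p s | below 0 (s≤s z≤n)
  ... | true  | ¬pₛ = contradiction _ ¬pₛ
  ... | false | _   = subst (λ d → firstTrue p (suc s) fuel ≡ just d) (ℕP.+-suc j s)
    (firstTrue-least p j j<fuel
      (λ i i<j → subst (¬_ ∘ T ∘ p) (sym (ℕP.+-suc i s)) (below (suc i) (s≤s i<j)))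
      (subst (T ∘ p) (sym (ℕP.+-suc j s)) pⱼ))

  dist-sound : ∀ {x y d} → dist x y ≡ just d → T (walk d x y)
  dist-sound = firstTrue-sound _ 0 (suc N)

  dist-positive : ∀ {x y d} → x ≢ y → dist x y ≡ just d → 1 ≤ d
  dist-positive {d = zero}  x≢y dxy = contradiction (walk₀⁻ (dist-sound dxy)) x≢y
  dist-positive {d = suc _} _   _   = s≤s z≤n

  dist-adjacent : ∀ {x y} → x ≢ y → x ~ y → dist x y ≡ just 1
  dist-adjacent {x} x≢y x~y =
    firstTrue-least _ 1 (s≤s (ℕP.≤-<-trans z≤n (FinP.toℕ<n x))) below (walk₁⁺ x~y)
    where
    below : ∀ i → i < 1 → ¬ T (walk (i ℕ.+ 0) _ _)
    below zero    _        = x≢y ∘ walk₀⁻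
    below (suc _) (s≤s ())

  dist-two : ∀ {x v y} → x ≢ y → ¬ x ~ y → x ~ v → v ~ y → dist x y ≡ just 2
  dist-two x≢y x≁y x~v v~y = firstTrue-least _ 2 (s≤s (≢⇒2≤ x≢y)) below (walk₂⁺ x~v v~y)
    where
    below : ∀ i → i < 2 → ¬ T (walk (i ℕ.+ 0) _ _)
    below zero          _              = x≢y ∘ walk₀⁻
    below (suc zero)    _              = x≁y ∘ walk₁⁻
    below (suc (suc _)) (s≤s (s≤s ()))

  pathLen-∷ : ∀ {k d l} x y (ys : Vec (Fin N) k) → x ≢ y → dist x y ≡ just d →
              pathLen (y ∷ ys) ≡ just l → pathLen (x ∷ y ∷ ys) ≡ just (d ℕ.+ l)
  pathLen-∷ x y ys x≢y dxy lys with x FinP.≟ y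
  ... | yes x≡y = contradiction x≡y x≢y
  ... | no _ rewrite dxy | lys = refl

  pathLen-∷⁻ : ∀ {k L} x y (ys : Vec (Fin N) k) → pathLen (x ∷ y ∷ ys) ≡ just L →
               ∃₂ λ d l → x ≢ y × dist x y ≡ just d × pathLen (y ∷ ys) ≡ just l × L ≡ d ℕ.+ l
  pathLen-∷⁻ x y ys eq with x FinP.≟ y | dist x y in dxy | pathLen (y ∷ ys) in lys
  ... | no x≢y | just d | just l = d , l , x≢y , refl , refl , sym (just-injective eq)

  pathLen-≥ : ∀ {k L} (xs : Tuple k) → pathLen xs ≡ just L → k ≤ L
  pathLen-≥ (x ∷ [])     _  = z≤n
  pathLen-≥ (x ∷ y ∷ ys) eq with pathLen-∷⁻ x y ys eq
  ... | d , l , x≢y , dxy , lys , refl = ℕP.+-mono-≤ (dist-positive x≢y dxy) (pathLen-≥ (y ∷ ys) lys)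

  pathLen-consecutive-≢ : ∀ {k L} (xs : Tuple k) → pathLen xs ≡ just L →
                          ∀ j → lookup xs (inject₁ j) ≢ lookup xs (suc j)
  pathLen-consecutive-≢ (x ∷ y ∷ ys) eq zero    with pathLen-∷⁻ x y ys eq
  ... | _ , _ , x≢y , _ = x≢y
  pathLen-consecutive-≢ (x ∷ y ∷ ys) eq (suc j) with pathLen-∷⁻ x y ys eq
  ... | _ , _ , _ , _ , lys , _ = pathLen-consecutive-≢ (y ∷ ys) lys j

  pathLen-tight⇒linked : ∀ {k} (xs : Tuple k) → pathLen xs ≡ just k → Linked _~_ xs
  pathLen-tight⇒linked         (x ∷ [])     _  = [-]
  pathLen-tight⇒linked {suc k} (x ∷ y ∷ ys) eq with pathLen-∷⁻ x y ys eq
  ... | zero  , _ , x≢y , dxy , _ = contradiction (walk₀⁻ (dist-sound dxy)) x≢y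
  ... | suc d , l , x≢y , dxy , lys , 1+k≡1+d+l with k≤l ← pathLen-≥ (y ∷ ys) lys =
    walk₁⁻ (dist-sound (subst (λ d → dist x y ≡ just (suc d)) d≡0 dxy)) ∷
    pathLen-tight⇒linked (y ∷ ys) (subst (λ l → pathLen (y ∷ ys) ≡ just l) l≡k lys)
    where
    d+l≡k : d ℕ.+ l ≡ k
    d+l≡k = sym (ℕP.suc-injective 1+k≡1+d+l)

    l≡k : l ≡ k
    l≡k = ℕP.≤-antisym (subst (l ≤_) d+l≡k (ℕP.m≤n+m l d)) k≤l

    d≡0 : d ≡ 0
    d≡0 = ℕP.+-cancelʳ-≡ l d 0 (trans d+l≡k (sym l≡k))

  isPath⁺ : ∀ {k ℓ} (xs : Tuple k) → pathLen xs ≡ just ℓ → isPath ℓ xs ≡ true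
  isPath⁺ {ℓ = ℓ} xs eq rewrite eq with ℓ ℕ.≟ ℓ
  ... | yes _   = refl
  ... | no ℓ≢ℓ = contradiction refl ℓ≢ℓ

  isPath⁻ : ∀ {k ℓ} (xs : Tuple k) → isPath ℓ xs ≡ true → pathLen xs ≡ just ℓ
  isPath⁻ {ℓ = ℓ} xs eq with pathLen xs
  ... | just l with l ℕ.≟ ℓ
  ...   | yes refl = refl

module Diagonal {N : ℕ} (adj : Fin N → Fin N → Bool) where
  open MH adj
  open Paths adj

  isPath-diagonal : ∀ {k} (xs : Tuple (suc k)) → isPath k xs ≡ false
  isPath-diagonal {k} xs with isPath k xs in eq
  ... | true  = contradiction (pathLen-≥ xs (isPath⁻ xs eq)) ℕP.1+n≰n
  ... | false = refl

  insertBetween : ∀ {k} → Tuple k → Fin k → Fin N → Tuple (suc k)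
  insertBetween y j v = insertAt y (suc (inject₁ j)) v

  restrict : ∀ {k} ℓ → (Tuple k → ℤ) → Tuple k → ℤ
  restrict ℓ c x = if isPath ℓ x then c x else 0ℤ

  restrict-chain : ∀ {k ℓ} (c : Chain k ℓ) x → restrict ℓ (proj₁ c) x ≡ proj₁ c x
  restrict-chain {ℓ = ℓ} (c , c-supported) x with isPath ℓ x in eq
  ... | true  = refl
  ... | false = sym (c-supported x eq)

  restrict≡0 : ∀ {k} ℓ (c : Tuple k → ℤ) x → (isPath ℓ x ≡ true → c x ≡ 0ℤ) → restrict ℓ c x ≡ 0ℤ
  restrict≡0 ℓ c x c≡0 with isPath ℓ x
  ... | true  = c≡0 refl
  ... | false = refl

  ∂-term : ∀ {k} ℓ → (Tuple (suc k) → ℤ) → Tuple k → Fin k → ℤ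
  ∂-term ℓ c y j = sign (suc (toℕ j)) ℤ.* ∑ N (λ v → restrict ℓ c (insertBetween y j v))

  ∂-on-path : ∀ {k} ℓ (c : Tuple (suc k) → ℤ) y → isPath ℓ y ≡ true → ∂ ℓ c y ≡ ∑ k (∂-term ℓ c y)
  ∂-on-path {k} ℓ c y y-path = cong (λ b → if b then ∑ k (∂-term ℓ c y) else 0ℤ) y-path

  ∂-vanishes : ∀ {k} ℓ (c : Tuple (suc k) → ℤ) y →
               (isPath ℓ y ≡ true → ∀ j v → isPath ℓ (insertBetween y j v) ≡ true →
                c (insertBetween y j v) ≡ 0ℤ) →
               ∂ ℓ c y ≡ 0ℤ
  ∂-vanishes {k} ℓ c y c≡0 with isPath ℓ y
  ... | false = refl
  ... | true  = ∑-zero k λ j →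
    trans (cong (sign (suc (toℕ j)) ℤ.*_) (∑-zero N λ v → restrict≡0 ℓ c _ (c≡0 refl j v)))
          (ℤP.*-zeroʳ (sign (suc (toℕ j))))

  isBoundary-zero : ∀ {k ℓ} {f : Tuple k → ℤ} → (∀ x → f x ≡ 0ℤ) → IsBoundary k ℓ f
  isBoundary-zero {ℓ = ℓ} f≡0 =
    ((λ _ → 0ℤ) , λ _ _ → refl) , λ x → trans (f≡0 x) (sym (∂-vanishes ℓ _ x λ _ _ _ _ → refl))

  diagonal-boundary≡0 : ∀ {k} {f : Tuple k → ℤ} → IsBoundary k k f → ∀ x → f x ≡ 0ℤ
  diagonal-boundary≡0 {k} ((b , b-supported) , f≡∂b) x =
    trans (f≡∂b x) (∂-vanishes k b x λ _ j v _ → b-supported _ (isPath-diagonal (insertBetween x j v)))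

  ⟦_⟧ : ∀ {k ℓ} → Cycle k ℓ → Tuple k → ℤ
  ⟦ z ⟧ = proj₁ (proj₁ z)

  diagonal-torsionFree : ∀ k → TorsionFree k k
  diagonal-torsionFree k z m m≢0 mz-boundary = isBoundary-zero z≡0
    where
    z≡0 : ∀ x → ⟦ z ⟧ x ≡ 0ℤ
    z≡0 x with ℤP.i*j≡0⇒i≡0∨j≡0 m (diagonal-boundary≡0 mz-boundary x)
    ... | inj₁ m≡0  = contradiction m≡0 m≢0
    ... | inj₂ zx≡0 = zx≡0

  _≟ᵗ_ : ∀ {k} → DecidableEquality (Tuple k)
  _≟ᵗ_ = VecP.≡-dec FinP._≟_

  δ : ∀ {k} → Tuple k → Tuple k → ℤ
  δ y x with x ≟ᵗ y
  ... | yes _ = 1ℤ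
  ... | no _  = 0ℤ

  δ-self : ∀ {k} (y : Tuple k) → δ y y ≡ 1ℤ
  δ-self y with y ≟ᵗ y
  ... | yes _   = refl
  ... | no y≢y = contradiction refl y≢y

  δ-other : ∀ {k} {x y : Tuple k} → x ≢ y → δ y x ≡ 0ℤ
  δ-other {x = x} {y} x≢y with x ≟ᵗ y
  ... | yes x≡y = contradiction x≡y x≢y
  ... | no _    = refl

  diagonal-hasRank : ∀ {k r} (basis : Fin r → Tuple k) → Injective _≡_ _≡_ basis →
                     (∀ e → isPath k (basis e) ≡ true) → (∀ e → IsCycle k k (δ (basis e))) →
                     (∀ x → (∃ λ e → x ≡ basis e) ⊎ (∀ (z : Cycle k k) → ⟦ z ⟧ x ≡ 0ℤ)) →
                     HasRank k k r
  diagonal-hasRank {k} {r} basis basis-injective basis-path basis-cycle spanning =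
    (indicator , independent) , maximal
    where
    indicator : Fin r → Cycle k k
    indicator e = (δ (basis e) , λ x x-not-path → δ-other λ { refl →
      contradiction (trans (sym x-not-path) (basis-path e)) λ () }) , basis-cycle e

    lin-at-basis : ∀ a e → lin a indicator (basis e) ≡ a e
    lin-at-basis a e = begin
      ∑ r (λ i → a i ℤ.* δ (basis i) (basis e))
        ≡⟨ ∑-single e (λ i i≢e → trans (cong (a i ℤ.*_) (δ-other (i≢e ∘ basis-injective ∘ sym)))
                                        (ℤP.*-zeroʳ (a i))) ⟩
      a e ℤ.* δ (basis e) (basis e) ≡⟨ cong (a e ℤ.*_) (δ-self (basis e)) ⟩
      a e ℤ.* 1ℤ                    ≡⟨ ℤP.*-identityʳ (a e) ⟩
      a e                           ∎
      where open ≡-Reasoning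

    independent : Independent indicator
    independent a lin-boundary e =
      trans (sym (lin-at-basis a e)) (diagonal-boundary≡0 lin-boundary (basis e))

    maximal : (z : Fin (suc r) → Cycle k k) → ¬ Independent z
    maximal z z-independent with rows-dependent (ℕP.n<1+n r) (λ i e → ⟦ z i ⟧ (basis e))
    ... | a , (i , aᵢ≢0) , a-relation = aᵢ≢0 (z-independent a (isBoundary-zero lin≡0) i)
      where
      lin≡0 : ∀ x → lin a z x ≡ 0ℤ
      lin≡0 x with spanning x
      ... | inj₁ (e , refl) = trans (∑≡sum (suc r) (λ i → a i ℤ.* ⟦ z i ⟧ (basis e))) (a-relation e)
      ... | inj₂ z≡0        = ∑-zero _ λ i → trans (cong (a i ℤ.*_) (z≡0 (z i))) (ℤP.*-zeroʳ (a i))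

  diagonal-rank₀ : HasRank 0 0 N
  diagonal-rank₀ = diagonal-hasRank (_∷ []) VecP.∷-injectiveˡ (λ _ → refl) (λ _ → tt)
                     λ { (x ∷ []) → inj₁ (x , refl) }

  bounce : Fin N → Fin N → (n : ℕ) → Tuple n
  bounce a b zero    = a ∷ []
  bounce a b (suc n) = a ∷ bounce b a n

  head-bounce : ∀ a b n → Vec.head (bounce a b n) ≡ a
  head-bounce a b zero    = refl
  head-bounce a b (suc n) = refl

  insertion-into-bounce : ∀ {k} (y : Tuple k) j v {a b} → insertBetween y j v ≡ bounce a b (suc k) →
                          lookup y (inject₁ j) ≡ lookup y (suc j)
  insertion-into-bounce {suc k} (y₀ ∷ y₁ ∷ ys) zero    v {a} {b} eq =
    trans (VecP.∷-injectiveˡ eq)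
          (sym (trans (cong Vec.head (VecP.∷-injectiveʳ (VecP.∷-injectiveʳ eq))) (head-bounce a b k)))
  insertion-into-bounce         (y₀ ∷ y₁ ∷ ys) (suc j) v eq =
    insertion-into-bounce (y₁ ∷ ys) j v (VecP.∷-injectiveʳ eq)

  δ-bounce-isCycle : ∀ {k} a b → IsCycle (suc k) (suc k) (δ (bounce a b (suc k)))
  δ-bounce-isCycle {k} a b y = ∂-vanishes (suc k) (δ (bounce a b (suc k))) y λ y-path j v _ →
    δ-other λ eq → pathLen-consecutive-≢ y (isPath⁻ y y-path) j (insertion-into-bounce y j v eq)

  Shortcut : ∀ {k} → Tuple (suc k) → Set
  Shortcut x = ∃ λ y → ∃₂ λ g w →
    x ≡ insertBetween y g w × lookup y (inject₁ g) ≢ lookup y (suc g)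

  bounce-or-shortcut : ∀ {k} x₀ x₁ (xs : Vec (Fin N) k) →
                       x₀ ∷ x₁ ∷ xs ≡ bounce x₀ x₁ (suc k) ⊎ Shortcut (x₀ ∷ x₁ ∷ xs)
  bounce-or-shortcut x₀ x₁ []        = inj₁ refl
  bounce-or-shortcut x₀ x₁ (x₂ ∷ xs) with x₀ FinP.≟ x₂
  ... | no x₀≢x₂ = inj₂ (x₀ ∷ x₂ ∷ xs , zero , x₁ , refl , x₀≢x₂)
  ... | yes refl with bounce-or-shortcut x₁ x₀ xs
  ...   | inj₁ eq                     = inj₁ (cong (x₀ ∷_) eq)
  ...   | inj₂ (y , g , w , eq , gap) = inj₂ (x₀ ∷ y , suc g , w , cong (x₀ ∷_) eq , gap)

Fin-∑ℕ : ∀ n (g : Fin n → ℕ) → Fin (∑ℕ n g) ↔ Σ (Fin n) (Fin ∘ g)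
Fin-∑ℕ zero    g = mk↔ₛ′ (λ ()) (λ ()) (λ ()) (λ ())
Fin-∑ℕ (suc n) g = ↔-trans FinP.+↔⊎ (↔-trans (↔-refl ⊎-↔ Fin-∑ℕ n (g ∘ suc)) ⊎↔Σ)
  where
  ⊎↔Σ : (Fin (g zero) ⊎ Σ (Fin n) (Fin ∘ g ∘ suc)) ↔ Σ (Fin (suc n)) (Fin ∘ g)
  ⊎↔Σ = mk↔ₛ′ [ (zero ,_) , (λ (i , t) → suc i , t) ]′
              (λ { (zero , t) → inj₁ t ; (suc i , t) → inj₂ (i , t) })
              (λ { (zero , t) → refl ; (suc i , t) → refl })
              (λ { (inj₁ t) → refl ; (inj₂ (i , t)) → refl })

Fin-if : ∀ b → Fin (if b then 1 else 0) ↔ T b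
Fin-if true  = FinP.1↔⊤
Fin-if false = FinP.0↔⊥

module DiagonalOfGirth≥5 {N : ℕ} (adj : Fin N → Fin N → Bool) (G : Girth≥5 (Paths._~_ adj)) where
  open MH adj
  open Paths adj
  open Diagonal adj
  open Girth≥5 G

  ~⇒≢ : ∀ {x y} → x ~ y → x ≢ y
  ~⇒≢ x~y refl = irreflexive x~y

  linked⇒pathLen : ∀ {k} (xs : Tuple k) → Linked _~_ xs → pathLen xs ≡ just k
  linked⇒pathLen (x ∷ [])     [-]          = refl
  linked⇒pathLen (x ∷ y ∷ ys) (x~y ∷ y∷ys) =
    pathLen-∷ x y ys (~⇒≢ x~y) (dist-adjacent (~⇒≢ x~y) x~y) (linked⇒pathLen (y ∷ ys) y∷ys)

  isPath⇔linked : ∀ {k} (xs : Tuple k) → isPath k xs ≡ true ⇔ Linked _~_ xs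
  isPath⇔linked xs = mk⇔ (pathLen-tight⇒linked xs ∘ isPath⁻ xs) (isPath⁺ xs ∘ linked⇒pathLen xs)

  linked-lookup : ∀ {k} (xs : Tuple k) g → Linked _~_ xs → lookup xs (inject₁ g) ~ lookup xs (suc g)
  linked-lookup (x₀ ∷ x₁ ∷ xs) zero    (x₀~x₁ ∷ _)  = x₀~x₁
  linked-lookup (x₀ ∷ x₁ ∷ xs) (suc g) (_ ∷ linked) = linked-lookup (x₁ ∷ xs) g linked

  inserted-neighbours : ∀ {k} (y : Tuple k) j v → Linked _~_ (insertBetween y j v) →
                        lookup y (inject₁ j) ~ v × v ~ lookup y (suc j)
  inserted-neighbours (y₀ ∷ y₁ ∷ ys) zero    v (y₀~v ∷ v~y₁ ∷ _) = y₀~v , v~y₁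
  inserted-neighbours (y₀ ∷ y₁ ∷ ys) (suc j) v (_ ∷ linked)      = inserted-neighbours (y₁ ∷ ys) j v linked

  inserted-elsewhere : ∀ {k} (y : Tuple k) j g v → Linked _~_ (insertBetween y j v) → j ≢ g →
                       lookup y (inject₁ g) ~ lookup y (suc g)
  inserted-elsewhere (y₀ ∷ y₁ ∷ ys) zero    zero    v _                j≢g = contradiction refl j≢g
  inserted-elsewhere (y₀ ∷ y₁ ∷ ys) zero    (suc g) v (_ ∷ _ ∷ linked) _   = linked-lookup (y₁ ∷ ys) g linked
  inserted-elsewhere (y₀ ∷ y₁ ∷ ys) (suc j) zero    v (y₀~y₁ ∷ _)      _   = y₀~y₁
  inserted-elsewhere (y₀ ∷ y₁ ∷ ys) (suc j) (suc g) v (_ ∷ linked)     j≢g =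
    inserted-elsewhere (y₁ ∷ ys) j g v linked (j≢g ∘ cong suc)

  shortcut-pathLen : ∀ {k} (y : Tuple k) g w → Linked _~_ (insertBetween y g w) →
                     lookup y (inject₁ g) ≢ lookup y (suc g) → pathLen y ≡ just (suc k)
  shortcut-pathLen (y₀ ∷ y₁ ∷ ys) zero    w (y₀~w ∷ w~y₁ ∷ linked) y₀≢y₁ =
    pathLen-∷ y₀ y₁ ys y₀≢y₁ (dist-two y₀≢y₁ (no-triangle y₀~w w~y₁) y₀~w w~y₁)
              (linked⇒pathLen (y₁ ∷ ys) linked)
  shortcut-pathLen (y₀ ∷ y₁ ∷ ys) (suc g) w (y₀~y₁ ∷ linked)       gap   =
    pathLen-∷ y₀ y₁ ys (~⇒≢ y₀~y₁) (dist-adjacent (~⇒≢ y₀~y₁) y₀~y₁)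
              (shortcut-pathLen (y₁ ∷ ys) g w linked gap)

  -- Only the term inserting w between y_g and y_{g+1} survives: inserting any vertex elsewhere
  -- needs y_g ~ y_{g+1}, a triangle with w, and inserting another vertex there closes a square.
  ∂-at-shortcut : ∀ {k} (c : Chain (suc k) (suc k)) y g w → Linked _~_ (insertBetween y g w) →
                  lookup y (inject₁ g) ≢ lookup y (suc g) →
                  ∂ (suc k) (proj₁ c) y ≡ sign (suc (toℕ g)) ℤ.* proj₁ c (insertBetween y g w)
  ∂-at-shortcut {k} (c , c-supported) y g w linked gap = begin
    ∂ (suc k) c y
      ≡⟨ ∂-on-path (suc k) c y (isPath⁺ y (shortcut-pathLen y g w linked gap)) ⟩
    ∑ k (∂-term (suc k) c y)
      ≡⟨ ∑-single g other-position ⟩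
    sign (suc (toℕ g)) ℤ.* ∑ N (λ v → restrict (suc k) c (insertBetween y g v))
      ≡⟨ cong (sign (suc (toℕ g)) ℤ.*_) (∑-single w other-vertex) ⟩
    sign (suc (toℕ g)) ℤ.* restrict (suc k) c (insertBetween y g w)
      ≡⟨ cong (sign (suc (toℕ g)) ℤ.*_) (restrict-chain (c , c-supported) (insertBetween y g w)) ⟩
    sign (suc (toℕ g)) ℤ.* c (insertBetween y g w)
      ∎
    where
    open ≡-Reasoning
    yg~w  = proj₁ (inserted-neighbours y g w linked)
    w~yg′ = proj₂ (inserted-neighbours y g w linked)

    path⇒linked : ∀ {x} → isPath (suc k) x ≡ true → Linked _~_ x
    path⇒linked = Equivalence.to (isPath⇔linked _)

    other-position : ∀ j → j ≢ g → ∂-term (suc k) c y j ≡ 0ℤ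
    other-position j j≢g = trans
      (cong (sign (suc (toℕ j)) ℤ.*_) (∑-zero N λ v → restrict≡0 _ c _ λ path →
        contradiction (inserted-elsewhere y j g v (path⇒linked path) j≢g) (no-triangle yg~w w~yg′)))
      (ℤP.*-zeroʳ (sign (suc (toℕ j))))

    other-vertex : ∀ v → v ≢ w → restrict (suc k) c (insertBetween y g v) ≡ 0ℤ
    other-vertex v v≢w = restrict≡0 _ c _ λ path →
      let yg~v , v~yg′ = inserted-neighbours y g v (path⇒linked path)
      in contradiction (no-square yg~v v~yg′ (symmetric w~yg′) (symmetric yg~w) gap) v≢w

  cycle-vanishes-at-shortcut : ∀ {k} (z : Cycle (suc k) (suc k)) {x} → Shortcut x → ⟦ z ⟧ x ≡ 0ℤ
  cycle-vanishes-at-shortcut {k} ((c , c-supported) , ∂c≡0) (y , g , w , refl , gap)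
    with isPath (suc k) (insertBetween y g w) in path
  ... | false = c-supported _ path
  ... | true with linked ← Equivalence.to (isPath⇔linked _) path
             with ℤP.i*j≡0⇒i≡0∨j≡0 (sign (suc (toℕ g)))
                    (trans (sym (∂-at-shortcut (c , c-supported) y g w linked gap)) (∂c≡0 y))
  ...   | inj₁ sign≡0 = contradiction sign≡0 (sign≢0 (suc (toℕ g)))
  ...   | inj₂ c≡0    = c≡0

  bounce-linked : ∀ {a b} n → a ~ b → Linked _~_ (bounce a b n)
  bounce-linked zero            _   = [-]
  bounce-linked (suc zero)      a~b = a~b ∷ [-]
  bounce-linked (suc (suc n))   a~b = a~b ∷ bounce-linked (suc n) (symmetric a~b)

  Arc : Set
  Arc = ∃₂ λ a b → a ~ b

  Edge : Set
  Edge = Σ (Fin N) λ i → Σ (Fin N) λ j → T ((toℕ i <ᵇ toℕ j) ∧ adj i j)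

  Fin-edgeCount : Fin edgeCount ↔ Edge
  Fin-edgeCount = ↔-trans (Fin-∑ℕ N _) (Σ.congˡ (↔-trans (Fin-∑ℕ N _) (Σ.congˡ (Fin-if _))))

  orientations : (Fin 2 × Edge) ↔ Arc
  orientations = mk↔ₛ′ orient unorient orient∘unorient unorient∘orient
    where
    increasing : ∀ {i j} → T ((toℕ i <ᵇ toℕ j) ∧ adj i j) → toℕ i < toℕ j
    increasing {i} {j} p =
      ℕP.<ᵇ⇒< (toℕ i) (toℕ j) (proj₁ (Equivalence.to (T-∧ {toℕ i <ᵇ toℕ j}) p))

    adjacent : ∀ {i j} → T ((toℕ i <ᵇ toℕ j) ∧ adj i j) → i ~ j
    adjacent {i} {j} p = proj₂ (Equivalence.to (T-∧ {toℕ i <ᵇ toℕ j}) p)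

    up : ∀ {i j} → toℕ i < toℕ j → i ~ j → T ((toℕ i <ᵇ toℕ j) ∧ adj i j)
    up i<j i~j = Equivalence.from T-∧ (ℕP.<⇒<ᵇ i<j , i~j)

    orient : Fin 2 × Edge → Arc
    orient (zero     , i , j , p) = i , j , adjacent p
    orient (suc zero , i , j , p) = j , i , symmetric (adjacent p)

    unorient : Arc → Fin 2 × Edge
    unorient (a , b , a~b) with ℕP.<-cmp (toℕ a) (toℕ b)
    ... | tri< a<b _ _ = zero , a , b , up a<b a~b
    ... | tri≈ _ a≡b _ = contradiction (subst (a ~_) (sym (FinP.toℕ-injective a≡b)) a~b) irreflexive
    ... | tri> _ _ b<a = suc zero , b , a , up b<a (symmetric a~b)

    orient∘unorient : ∀ arc → orient (unorient arc) ≡ arc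
    orient∘unorient (a , b , a~b) with ℕP.<-cmp (toℕ a) (toℕ b)
    ... | tri< _ _ _   = cong (λ p → a , b , p) (T-irrelevant _ _)
    ... | tri≈ _ a≡b _ = contradiction (subst (a ~_) (sym (FinP.toℕ-injective a≡b)) a~b) irreflexive
    ... | tri> _ _ _   = cong (λ p → a , b , p) (T-irrelevant _ _)

    unorient∘orient : ∀ s → unorient (orient s) ≡ s
    unorient∘orient (zero , i , j , p) with ℕP.<-cmp (toℕ i) (toℕ j)
    ... | tri< _ _ _   = cong (λ q → zero , i , j , q) (T-irrelevant _ _)
    ... | tri≈ i≮j _ _ = contradiction (increasing p) i≮j
    ... | tri> i≮j _ _ = contradiction (increasing p) i≮j
    unorient∘orient (suc zero , i , j , p) with ℕP.<-cmp (toℕ j) (toℕ i)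
    ... | tri< j<i _ _ = contradiction j<i (ℕP.<⇒≯ (increasing p))
    ... | tri≈ _ _ i≮j = contradiction (increasing p) i≮j
    ... | tri> _ _ _   = cong (λ q → suc zero , i , j , q) (T-irrelevant _ _)

  arcs : Fin (2 * edgeCount) ↔ Arc
  arcs = ↔-trans FinP.*↔× (↔-trans (↔-refl ×-↔ Fin-edgeCount) orientations)

  bounceAlong : ∀ k → Arc → Tuple (suc k)
  bounceAlong k (a , b , _) = bounce a b (suc k)

  bounceAlong-injective : ∀ k → Injective _≡_ _≡_ (bounceAlong k)
  bounceAlong-injective k {a , b , a~b} {a′ , b′ , a′~b′} eq with VecP.∷-injective eq
  ... | refl , eq′ with trans (sym (head-bounce b a k)) (trans (cong Vec.head eq′) (head-bounce b′ a′ k))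
  ...   | refl = cong (λ p → a , b , p) (T-irrelevant a~b a′~b′)

  diagonal-rank : ∀ k → HasRank (suc k) (suc k) (2 * edgeCount)
  diagonal-rank k = diagonal-hasRank basis basis-injective basis-path (λ _ → δ-bounce-isCycle _ _) spanning
    where
    open Inverse arcs using (to; from; strictlyInverseˡ)

    basis : Fin (2 * edgeCount) → Tuple (suc k)
    basis = bounceAlong k ∘ to

    basis-injective : Injective _≡_ _≡_ basis
    basis-injective = Injection.injective (↔⇒↣ arcs) ∘ bounceAlong-injective k

    basis-path : ∀ e → isPath (suc k) (basis e) ≡ true
    basis-path e = Equivalence.from (isPath⇔linked _) (bounce-linked (suc k) (proj₂ (proj₂ (to e))))

    spanning : ∀ x → (∃ λ e → x ≡ basis e) ⊎ (∀ (z : Cycle (suc k) (suc k)) → ⟦ z ⟧ x ≡ 0ℤ)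
    spanning (x₀ ∷ x₁ ∷ xs) with bounce-or-shortcut x₀ x₁ xs
    ... | inj₂ shortcut = inj₂ λ z → cycle-vanishes-at-shortcut z shortcut
    ... | inj₁ x≡bounce with T? (adj x₀ x₁)
    ...   | yes x₀~x₁ =
      inj₁ (from (x₀ , x₁ , x₀~x₁) , trans x≡bounce (cong (bounceAlong k) (sym (strictlyInverseˡ _))))
    ...   | no x₀≁x₁ = inj₂ λ z → proj₂ (proj₁ z) _
      (¬-not λ path → x₀≁x₁ (Linked.head (Equivalence.to (isPath⇔linked (x₀ ∷ x₁ ∷ xs)) path)))

next : ∀ {n} → Fin (suc n) → Fin (suc n)
next {n} i with n ℕP.≟ toℕ i
... | yes _   = zero
... | no n≢i = suc (Fin.lower₁ i n≢i)

next-injective : ∀ {n} → Injective _≡_ _≡_ (next {n})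
next-injective {n} {i} {j} eq with n ℕP.≟ toℕ i | n ℕP.≟ toℕ j
next-injective _  | yes n≡i | yes n≡j = FinP.toℕ-injective (trans (sym n≡i) n≡j)
next-injective () | yes _   | no _
next-injective () | no _    | yes _
next-injective eq | no _    | no _    = FinP.lower₁-injective (FinP.suc-injective eq)

next-step : ∀ {n} (i : Fin (suc n)) → (toℕ i ≡ n × next i ≡ zero) ⊎ toℕ (next i) ≡ suc (toℕ i)
next-step {n} i with n ℕP.≟ toℕ i
... | yes n≡i = inj₁ (sym n≡i , refl)
... | no n≢i  = inj₂ (cong suc (FinP.toℕ-lower₁ i n≢i))

next-inject₁ : ∀ {n} (i : Fin n) → next (inject₁ i) ≡ suc i
next-inject₁ {n} i with n ℕP.≟ toℕ (inject₁ i)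
... | yes n≡i = contradiction (trans n≡i (FinP.toℕ-inject₁ i)) (ℕP.<⇒≢ (FinP.toℕ<n i) ∘ sym)
... | no n≢i  = cong suc (FinP.lower₁-inject₁′ i n≢i)

next-fromℕ : ∀ n → next (Fin.fromℕ n) ≡ zero
next-fromℕ n with n ℕP.≟ toℕ (Fin.fromℕ n)
... | yes _   = refl
... | no n≢n = contradiction (sym (FinP.toℕ-fromℕ n)) n≢n

fold-next : ∀ {n} k (i : Fin (suc n)) → ∃ λ W → toℕ (fold i next k) ℕ.+ W * suc n ≡ toℕ i ℕ.+ k
fold-next zero i = 0 , refl
fold-next {n} (suc k) i with fold-next k i | next-step (fold i next k)
... | W , eq | inj₁ (last , wraps) = suc W , (begin
  toℕ (next (fold i next k)) ℕ.+ suc W * suc n ≡⟨ cong (λ j → toℕ j ℕ.+ suc W * suc n) wraps ⟩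
  suc (n ℕ.+ W * suc n)                       ≡⟨ cong (λ m → suc (m ℕ.+ W * suc n)) (sym last) ⟩
  suc (toℕ (fold i next k) ℕ.+ W * suc n)     ≡⟨ cong suc eq ⟩
  suc (toℕ i ℕ.+ k)                           ≡⟨ ℕP.+-suc (toℕ i) k ⟨
  toℕ i ℕ.+ suc k                             ∎)
  where open ≡-Reasoning
... | W , eq | inj₂ steps = W , (begin
  toℕ (next (fold i next k)) ℕ.+ W * suc n ≡⟨ cong (ℕ._+ W * suc n) steps ⟩
  suc (toℕ (fold i next k) ℕ.+ W * suc n)  ≡⟨ cong suc eq ⟩
  suc (toℕ i ℕ.+ k)                        ≡⟨ ℕP.+-suc (toℕ i) k ⟨
  toℕ i ℕ.+ suc k                          ∎)
  where open ≡-Reasoning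

fold-next-≢ : ∀ {n} k (i : Fin (suc n)) → 0 < k → k < suc n → fold i next k ≢ i
fold-next-≢ {n} k i 0<k k<1+n fixed with fold-next k i
... | W , eq with ℕP.+-cancelˡ-≡ (toℕ i) (W * suc n) k
                    (trans (cong (λ j → toℕ j ℕ.+ W * suc n) (sym fixed)) eq)
... | W*[1+n]≡k with W
...   | zero   = ℕP.<-irrefl W*[1+n]≡k 0<k
...   | suc W′ = ℕP.<-irrefl refl
                   (ℕP.<-≤-trans k<1+n (subst (suc n ≤_) W*[1+n]≡k (ℕP.m≤m+n (suc n) (W′ * suc n))))

lookup-injective : ∀ {A : Set} {n} (xs : Vec A n) → Unique (Vec.toList xs) → Injective _≡_ _≡_ (lookup xs)
lookup-injective (x ∷ xs) (_ ∷ unique) {zero}  {zero}  _  = refl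
lookup-injective (x ∷ xs) (x∉xs ∷ _)   {zero}  {suc j} eq =
  contradiction eq (All.lookup x∉xs (∈-toList⁺ (∈-lookup j xs)))
lookup-injective (x ∷ xs) (x∉xs ∷ _)   {suc i} {zero}  eq =
  contradiction (sym eq) (All.lookup x∉xs (∈-toList⁺ (∈-lookup i xs)))
lookup-injective (x ∷ xs) (_ ∷ unique) {suc i} {suc j} eq = cong suc (lookup-injective xs unique eq)

3≢2* : ∀ h → 3 ≢ 2 * h
3≢2* h 3≡2h = contradiction (trans (cong (ℕ._% 2) (trans 3≡2h (ℕP.*-comm 2 h))) (m*n%n≡0 h 2)) λ ()

module Components {N : ℕ} where

  HasEdge : Comp N → Fin N → Fin N → Set
  HasEdge H x y = T (hasEdge H x y)

  Joins : Fin N → Fin N → Fin N × Fin N → Set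
  Joins u v (a , b) = (u ≡ a × v ≡ b) ⊎ (u ≡ b × v ≡ a)

  Joins-sym : ∀ {u v} e → Joins u v e → Joins v u e
  Joins-sym _ (inj₁ (u≡a , v≡b)) = inj₂ (v≡b , u≡a)
  Joins-sym _ (inj₂ (u≡b , v≡a)) = inj₁ (v≡a , u≡b)

  sameEdge⁻ : ∀ u v e → T (sameEdge u v e) → Joins u v e
  sameEdge⁻ u v (a , b) h with Equivalence.to (T-∨ {⌊ u FinP.≟ a ⌋ ∧ ⌊ v FinP.≟ b ⌋}) h
  ... | inj₁ h₁ = let u≡a , v≡b = Equivalence.to (T-∧ {⌊ u FinP.≟ a ⌋}) h₁ in
    inj₁ (toWitness u≡a , toWitness v≡b)
  ... | inj₂ h₂ = let u≡b , v≡a = Equivalence.to (T-∧ {⌊ u FinP.≟ b ⌋}) h₂ in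
    inj₂ (toWitness u≡b , toWitness v≡a)

  sameEdge⁺ : ∀ u v e → Joins u v e → T (sameEdge u v e)
  sameEdge⁺ u v (a , b) (inj₁ (refl , refl)) =
    Equivalence.from (T-∨ {⌊ u FinP.≟ a ⌋ ∧ ⌊ v FinP.≟ b ⌋})
      (inj₁ (Equivalence.from (T-∧ {⌊ u FinP.≟ a ⌋} {⌊ v FinP.≟ b ⌋})
                              (fromWitness refl , fromWitness refl)))
  sameEdge⁺ u v (a , b) (inj₂ (refl , refl)) =
    Equivalence.from (T-∨ {⌊ u FinP.≟ a ⌋ ∧ ⌊ v FinP.≟ b ⌋})
      (inj₂ (Equivalence.from (T-∧ {⌊ u FinP.≟ b ⌋} {⌊ v FinP.≟ a ⌋})
                              (fromWitness refl , fromWitness refl)))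

  hasEdge⁻ : ∀ H u v → HasEdge H u v → ∃ λ e → e ∈ edges H × Joins u v e
  hasEdge⁻ H u v h =
    let e , e∈H , same = find (any⁻ (sameEdge u v) (edges H) h) in e , e∈H , sameEdge⁻ u v e same

  hasEdge-sym : ∀ H u v → HasEdge H u v → HasEdge H v u
  hasEdge-sym H u v h = let e , e∈H , joins = hasEdge⁻ H u v h in
    any⁺ (sameEdge v u) (lose e∈H (sameEdge⁺ v u e (Joins-sym e joins)))

  k2-joins : ∀ a b u v → HasEdge (k2 a b) u v → Joins u v (a , b)
  k2-joins a b u v h with hasEdge⁻ (k2 a b) u v h
  ... | _ , here refl , joins = joins

  k2-girth≥5 : ∀ {a b} → a ≢ b → Girth≥5 (HasEdge (k2 a b))
  k2-girth≥5 {a} {b} a≢b = record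
    { symmetric   = λ {x} {y} → hasEdge-sym (k2 a b) x y
    ; irreflexive = λ {x} → irreflexive x
    ; no-triangle = λ {x} {y} {z} x~y y~z x~z →
                      irreflexive x (subst (x ~_) (sym (two-steps x y z x~y y~z)) x~z)
    ; no-square   = λ {x} {y} {z} x~y y~z _ _ x≢z → contradiction (two-steps x y z x~y y~z) x≢z
    }
    where
    _~_ = HasEdge (k2 a b)

    irreflexive : ∀ x → ¬ x ~ x
    irreflexive x x~x with k2-joins a b x x x~x
    ... | inj₁ (refl , x≡b) = a≢b x≡b
    ... | inj₂ (refl , x≡a) = a≢b (sym x≡a)

    two-steps : ∀ x y z → x ~ y → y ~ z → x ≡ z
    two-steps x y z x~y y~z with k2-joins a b x y x~y | k2-joins a b y z y~z
    ... | inj₁ (refl , refl) | inj₁ (b≡a , _)  = contradiction (sym b≡a) a≢b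
    ... | inj₁ (refl , refl) | inj₂ (_ , refl) = refl
    ... | inj₂ (refl , refl) | inj₁ (_ , refl) = refl
    ... | inj₂ (refl , refl) | inj₂ (a≡b , _)  = contradiction a≡b a≢b

  cycEdges-∈ : ∀ {n} v₀ (ws : Vec (Fin N) (suc n)) {e} → e ∈ cycEdges v₀ ws →
               (∃ λ i → e ≡ (lookup ws (inject₁ i) , lookup ws (suc i))) ⊎
               e ≡ (lookup ws (Fin.fromℕ n) , v₀)
  cycEdges-∈ v₀ (x ∷ [])     (here refl) = inj₂ refl
  cycEdges-∈ v₀ (x ∷ y ∷ ws) (here refl) = inj₁ (zero , refl)
  cycEdges-∈ v₀ (x ∷ y ∷ ws) (there e∈)  with cycEdges-∈ v₀ (y ∷ ws) e∈
  ... | inj₁ (i , refl) = inj₁ (suc i , refl)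
  ... | inj₂ refl       = inj₂ refl

  CycleAdjacent : ∀ {n} → Vec (Fin N) (suc n) → Fin N → Fin N → Set
  CycleAdjacent vs x y = ∃₂ λ i j → x ≡ lookup vs i × y ≡ lookup vs j × (j ≡ next i ⊎ i ≡ next j)

  joins-consecutive : ∀ {n} (vs : Vec (Fin N) (suc n)) {x y} i →
                      Joins x y (lookup vs i , lookup vs (next i)) → CycleAdjacent vs x y
  joins-consecutive vs i (inj₁ (x≡ , y≡)) = i , next i , x≡ , y≡ , inj₁ refl
  joins-consecutive vs i (inj₂ (x≡ , y≡)) = next i , i , x≡ , y≡ , inj₂ refl

  cycle-edge : ∀ {m} (vs : Vec (Fin N) (3 ℕ.+ m)) x y → HasEdge (cyc m vs) x y → CycleAdjacent vs x y
  cycle-edge {m} vs@(v₀ ∷ _) x y h with hasEdge⁻ (cyc m vs) x y h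
  ... | e , e∈ , joins with cycEdges-∈ v₀ vs e∈
  ...   | inj₁ (i , refl) = joins-consecutive vs (inject₁ i)
    (subst (λ j → Joins x y (lookup vs (inject₁ i) , lookup vs j)) (sym (next-inject₁ i)) joins)
  ...   | inj₂ refl = joins-consecutive vs (Fin.fromℕ _)
    (subst (λ j → Joins x y (lookup vs (Fin.fromℕ _) , lookup vs j)) (sym (next-fromℕ _)) joins)

  cycle-girth≥5 : ∀ {m} (vs : Vec (Fin N) (5 ℕ.+ m)) → Unique (Vec.toList vs) →
                  Girth≥5 (HasEdge (cyc (2 ℕ.+ m) vs))
  cycle-girth≥5 {m} vs unique = girth≥5-image (lookup vs) (lookup-injective vs unique)
    (λ {x} {y} → hasEdge-sym (cyc (2 ℕ.+ m) vs) x y) (λ {x} {y} → cycle-edge vs x y)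
    (Successor.girth≥5 next next-injective (no-fixed-point 1 _ _) (no-fixed-point 3 _ _) (no-fixed-point 4 _ _))
    where
    no-fixed-point : ∀ k → T (0 <ᵇ k) → T (k <ᵇ 5) → ∀ i → fold i next k ≢ i
    no-fixed-point k 0<k k<5 i =
      fold-next-≢ k i (ℕP.<ᵇ⇒< 0 k 0<k) (ℕP.<-≤-trans (ℕP.<ᵇ⇒< k 5 k<5) (ℕP.m≤m+n 5 m))

  edge-in-verts : ∀ H x y → HasEdge H x y → x ∈ verts H
  edge-in-verts (k2 a b) x y x~y with k2-joins a b x y x~y
  ... | inj₁ (refl , _) = here refl
  ... | inj₂ (refl , _) = there (here refl)
  edge-in-verts (cyc m vs) x y x~y with cycle-edge vs x y x~y
  ... | i , _ , refl , _ = ∈-toList⁺ (∈-lookup i vs)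

  component-girth≥5 : ∀ H → CompWF H → GoodComp H → Girth≥5 (HasEdge H)
  component-girth≥5 (k2 a b)               ((a≢b ∷ []) ∷ _) _                = k2-girth≥5 a≢b
  component-girth≥5 (cyc zero vs)          _                ((h , 3≡2h) , _) = contradiction 3≡2h (3≢2* h)
  component-girth≥5 (cyc (suc zero) vs)    _                (_ , 4≢4)        = contradiction refl 4≢4
  component-girth≥5 (cyc (suc (suc m)) vs) unique           _                = cycle-girth≥5 vs unique

module Gluing {N : ℕ} where
  open Components {N}

  AdjOf : List (Comp N) → Fin N → Fin N → Set
  AdjOf Hs x y = T (adjOf Hs x y)

  adjOf-snoc : ∀ prev H {x y} → (AdjOf prev ∪ HasEdge H) x y ⇔ AdjOf (prev ++ H ∷ []) x y
  adjOf-snoc prev H {x} {y} = mk⇔ to from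
    where
    to : (AdjOf prev ∪ HasEdge H) x y → AdjOf (prev ++ H ∷ []) x y
    to (inj₁ x~y) = any⁺ _ (++⁺ˡ (any⁻ _ prev x~y))
    to (inj₂ x~y) = any⁺ _ (++⁺ʳ prev (here x~y))

    from : AdjOf (prev ++ H ∷ []) x y → (AdjOf prev ∪ HasEdge H) x y
    from x~y with ++⁻ prev (any⁻ _ (prev ++ H ∷ []) x~y)
    ... | inj₁ in-prev    = inj₁ (any⁺ _ in-prev)
    ... | inj₂ (here x~y) = inj₂ x~y

  Invariant : List (Comp N) → Set
  Invariant prev = Girth≥5 (AdjOf prev) × (∀ {x y} → AdjOf prev x y → x ∈ concatMap verts prev)

  SharedAdjacent : List (Comp N) → Comp N → Set
  SharedAdjacent prev H = ∀ {x y} → x ∈ concatMap verts prev → x ∈ verts H →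
                          y ∈ concatMap verts prev → y ∈ verts H → x ≢ y → AdjOf prev x y × HasEdge H x y

  attach-sharedAdjacent : ∀ prev H → (∀ x y → AdjOf prev x y → AdjOf prev y x) → Attach prev H →
                          SharedAdjacent prev H
  attach-sharedAdjacent prev H _ (inj₁ (w , _ , only-w)) {x} {y} x∈prev x∈H y∈prev y∈H x≢y =
    contradiction (trans (proj₁ (only-w x x∈H) x∈prev) (sym (proj₁ (only-w y y∈H) y∈prev))) x≢y
  attach-sharedAdjacent prev H adjOf-sym (inj₂ (u , v , uv∈H , (uv∈prev , _) , only-uv))
                        {x} {y} x∈prev x∈H y∈prev y∈H x≢y
    with proj₁ (only-uv x x∈H) x∈prev | proj₁ (only-uv y y∈H) y∈prev
  ... | inj₁ refl | inj₁ refl = contradiction refl x≢y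
  ... | inj₂ refl | inj₂ refl = contradiction refl x≢y
  ... | inj₁ refl | inj₂ refl = Equivalence.from T-≡ uv∈prev , Equivalence.from T-≡ uv∈H
  ... | inj₂ refl | inj₁ refl =
    adjOf-sym u v (Equivalence.from T-≡ uv∈prev) , hasEdge-sym H u v (Equivalence.from T-≡ uv∈H)

  attach-component : ∀ prev H → Invariant prev → CompWF H → GoodComp H → SharedAdjacent prev H →
                     Invariant (prev ++ H ∷ [])
  attach-component prev H (G , ∈prev) wf good shared =
    Girth≥5-resp-⇔ (λ {x} {y} → adjOf-snoc prev H {x} {y})
      (Union.girth≥5 FinP._≟_ G (component-girth≥5 H wf good) ∈prev (λ {x} {y} → edge-in-verts H x y)
                     shared) ,
    ∈prev++H
    where
    ∈prev++H : ∀ {x y} → AdjOf (prev ++ H ∷ []) x y → x ∈ concatMap verts (prev ++ H ∷ [])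
    ∈prev++H {x} {y} x~y rewrite LP.concatMap-++ verts prev (H ∷ [])
      with Equivalence.from (adjOf-snoc prev H {x} {y}) x~y
    ... | inj₁ x~y = ∈-++⁺ˡ (∈prev x~y)
    ... | inj₂ x~y = ∈-++⁺ʳ (concatMap verts prev) (∈-++⁺ˡ (edge-in-verts H x y x~y))

  attachSeq-invariant : ∀ prev Hs → Invariant prev → AttachSeq prev Hs → All GoodComp Hs →
                        Invariant (prev ++ Hs)
  attachSeq-invariant prev []       invariant _                        []              =
    subst Invariant (sym (LP.++-identityʳ prev)) invariant
  attachSeq-invariant prev (H ∷ Hs) invariant (wf , attach , attaches) (good ∷ goods) =
    subst Invariant (LP.++-assoc prev (H ∷ []) Hs)
      (attachSeq-invariant (prev ++ H ∷ []) Hs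
        (attach-component prev H invariant wf good
          (attach-sharedAdjacent prev H (λ x y → Girth≥5.symmetric (proj₁ invariant) {x} {y}) attach))
        attaches goods)

  outerplanar-girth≥5 : ∀ {H₁ Hs} → Outerplanar N H₁ Hs → All GoodComp (H₁ ∷ Hs) →
                        Girth≥5 (AdjOf (H₁ ∷ Hs))
  outerplanar-girth≥5 {H₁} {Hs} (wf , attaches , _) (good ∷ goods) =
    proj₁ (attachSeq-invariant (H₁ ∷ []) Hs (attach-component [] H₁ empty wf good λ ()) attaches goods)
    where
    empty : Invariant []
    empty = record { symmetric = λ () ; irreflexive = λ () ; no-triangle = λ () ; no-square = λ () } , λ ()

theorem4p5 : (N : ℕ) (H₁ : Comp N) (Hs : List (Comp N))
    → Outerplanar N H₁ Hs
    → All GoodComp (H₁ ∷ Hs)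
    → ((k : ℕ) → MH.TorsionFree (adjOf (H₁ ∷ Hs)) k k)
      × MH.HasRank (adjOf (H₁ ∷ Hs)) 0 0 N
      × ((k : ℕ) → MH.HasRank (adjOf (H₁ ∷ Hs)) (suc k) (suc k) (2 * MH.edgeCount (adjOf (H₁ ∷ Hs))))
theorem4p5 N H₁ Hs outerplanar good =
  diagonal-torsionFree , diagonal-rank₀ , diagonal-rank
  where
  open Diagonal (adjOf (H₁ ∷ Hs)) using (diagonal-torsionFree; diagonal-rank₀)
  open DiagonalOfGirth≥5 (adjOf (H₁ ∷ Hs)) (Gluing.outerplanar-girth≥5 outerplanar good)
    using (diagonal-rank)
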